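{- Let $n\ge1$, $S\subseteq\{0,1,\dots,n-1\}$, and $i=r_n(S)$. The map $\psi$ sending $\pi\in D_n^+(S)$ to $(\sigma,X)$, where $\sigma=\operatorname{sst}([\pi(1),\dots,\pi(n-i-1)])$ and $X=\{\pi(n-i),\pi(n-i+1),\dots,\pi(n)\}$, is a bijection \[\psi:D_n^+(S)\to D_{n-i-1}\big(S\cap\{0,1,\dots,n-i-2\}\big)\times\binom{[n]}{i+1}.\] Consequently $|D_n^+(S)|=\big|D_{n-i-1}(S\cap\{0,\dots,n-i-2\})\big|\binom{n}{i+1}$.
   Context: $D_m$ is the group of even signed permutations of $[m]$: bijections $\pi$ of $[-m,m]$ with $\pi(-j)=-\pi(j)$ having an even number of negative entries among $\pi(1),\dots,\pi(m)$, written $[\pi(1),\dots,\pi(m)]$. For a word $w=[w(1),\dots,w(m)]$ of integers, $\operatorname{Des}(w)=\{j\in[m-1]:w(j)\ge w(j+1)\}$ and $\operatorname{Des}_D(w)$ equals $\operatorname{Des}(w)\cup\{0\}$ if $w(1)+w(2)<0$ and $\operatorname{Des}(w)$ otherwise (for $m\le1$, $\operatorname{Des}_D(w)=\emptyset$). For $T\subseteq\{0,\dots,m-1\}$ and $U\subseteq D_m$ set $U(T)=\{\pi\in U:\operatorname{Des}_D(\pi)\supseteq T\}$. Let $D_n^+=\{\pi\in D_n:\pi(n)>0\}$. Define $r_n(S)=\max\{j:\{n-j,\dots,n-1\}\subseteq S\}$, with $r_n(S)=0$ if $n-1\notin S$. $\binom{[n]}{j}$ is the set of $j$-element subsets of $[n]=\{1,\dots,n\}$.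 Signed standardization: if $w$ is a word of nonzero integers whose absolute values $|w(1)|,\dots,|w(m)|$ are distinct elements $c_1<\dots<c_m$ of a set $C$, let $\operatorname{st}(|w|)$ be obtained from $[|w(1)|,\dots,|w(m)|]$ by replacing $c_j$ with $j$, and $\operatorname{sst}(w)(j)=\operatorname{st}(|w|)(j)$ if $w(j)>0$ and $-\operatorname{st}(|w|)(j)$ if $w(j)<0$. -}

module Defs where

open import Data.Nat as ℕ using (ℕ; zero; suc; _∸_; _<_; _≤_; _<?_)
open import Data.Nat.Divisibility using (_∣_)
open import Data.Integer as ℤ using (ℤ; +_; -_; 0ℤ)
open import Data.Integer.Properties using (_≟_)
open import Data.Bool using (Bool; true; false; if_then_else_)
open import Data.List using (List; []; _∷_; length; filter; map; upTo; take; drop)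
open import Data.List.Relation.Unary.Any using (any?)
open import Data.List.Relation.Binary.Permutation.Propositional using (_↭_)
open import Data.List.Relation.Unary.Unique.Propositional using (Unique)
import Data.List.Membership.Propositional as LM
open import Data.Fin using (Fin; toℕ)
open import Data.Fin.Subset using (Subset; _∈_) renaming (∣_∣ to size)
open import Data.Vec using (tabulate)
open import Data.Product using (Σ; _×_; _,_)
open import Relation.Nullary using (does; ¬_)
open import Relation.Binary.PropositionalEquality using (_≡_)

-- Words are lists of integers, written [w(1),...,w(m)].
-- ent w j = w(j) (1-based); value 0 outside the range 1..length w (never used there).
ent : List ℤ → ℕ → ℤ
ent []       _             = 0ℤ
ent (a ∷ w)  zero          = 0ℤ
ent (a ∷ w)  (suc zero)    = a
ent (a ∷ w)  (suc (suc j)) = ent w (suc j)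

negCount : List ℤ → ℕ
negCount w = length (filter (λ a → a ℤ.<? 0ℤ) w)

-- w ∈ D_m : the absolute values |w(1)|,...,|w(m)| are a rearrangement of 1,...,m
-- (so w is the window of a signed permutation of [m]), and the number of
-- negative entries is even.
InD : ℕ → List ℤ → Set
InD m w = (map ℤ.∣_∣ w ↭ map suc (upTo m)) × (2 ∣ negCount w)

InDplus : ℕ → List ℤ → Set
InDplus n w = InD n w × (0ℤ ℤ.< ent w n)

DesD : List ℤ → ℕ → Set
DesD w zero    = (2 ≤ length w) × (ent w 1 ℤ.+ ent w 2 ℤ.< 0ℤ)
DesD w (suc j) = (suc j < length w) × (ent w (suc (suc j)) ℤ.≤ ent w (suc j))

-- membership of a natural number x in S ⊆ {0,...,n-1}  (S as a Subset n,
-- the Fin n element k standing for the number toℕ k)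
_∈ₛ_ : {n : ℕ} → ℕ → Subset n → Set
_∈ₛ_ {n} x S = Σ (Fin n) (λ k → (toℕ k ≡ x) × (k ∈ S))

DesContains : List ℤ → (ℕ → Set) → Set
DesContains w T = (x : ℕ) → T x → DesD w x

InDplusS : (n : ℕ) → Subset n → List ℤ → Set
InDplusS n S w = InDplus n w × DesContains w (λ x → x ∈ₛ S)

InDS∩ : (k : ℕ) → {n : ℕ} → Subset n → List ℤ → Set
InDS∩ k S w = InD k w × DesContains w (λ x → (x < k) × (x ∈ₛ S))

-- i = r_n(S): the maximum j (with 0 ≤ j ≤ n) such that {n-j,...,n-1} ⊆ S.
-- (j ≤ n is forced since S ⊆ {0,...,n-1}; for j = 0 the set is empty.)
SuffixIn : (n : ℕ) → Subset n → ℕ → Set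
SuffixIn n S j = (j ≤ n) × ((x : ℕ) → n ∸ j ≤ x → x < n → x ∈ₛ S)

IsRn : (n : ℕ) → Subset n → ℕ → Set
IsRn n S i = SuffixIn n S i × ((j : ℕ) → SuffixIn n S j → j ≤ i)

-- signed standardization: entry a is replaced by ±(rank of |a| among the
-- absolute values of w), sign + iff a > 0.
sst : List ℤ → List ℤ
sst w = map (λ a → signed a (suc (length (filter (λ b → ℤ.∣ b ∣ <? ℤ.∣ a ∣) w)))) w
  where
  signed : ℤ → ℕ → ℤ
  signed a r = if does (0ℤ ℤ.<? a) then + r else - (+ r)

-- the subset {π(n-i),...,π(n)} of [n]; the Fin n element k stands for the value k+1.
-- (drop (n-i-1) π = [π(n-i),...,π(n)].)
valueSet : (n i : ℕ) → List ℤ → Subset n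
valueSet n i π = tabulate (λ k → does (any? (λ a → a ≟ + suc (toℕ k)) (drop (n ∸ i ∸ 1) π)))

ψ : (n i : ℕ) → List ℤ → List ℤ × Subset n
ψ n i π = sst (take (n ∸ i ∸ 1) π) , valueSet n i π

InCod : (n : ℕ) → Subset n → (i : ℕ) → List ℤ × Subset n → Set
InCod n S i (σ , X) = InDS∩ (n ∸ i ∸ 1) S σ × (size X ≡ suc i)

HasCard : {A : Set} → (A → Set) → ℕ → Set
HasCard {A} P c = Σ (List A) (λ l → Unique l × (length l ≡ c) ×
                    ((a : A) → (a LM.∈ l → P a) × (P a → a LM.∈ l)))

-- The positions n-i, …, n-1 lie in S, so π is weakly decreasing on its last i+1 entries;
-- as π(n) > 0 these entries are positive and (being distinct) strictly decreasing, hence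
-- they are X listed downwards, and the first n-i-1 entries have absolute values [n] ∖ X.
-- All negative entries of π sit in that prefix, and signed standardization preserves
-- signs, descents, and (being odd in each entry) the type-D descent at 0, so σ lies in
-- D_{n-i-1}(S ∩ {0,…,n-i-2}). Conversely, σ inflated to the alphabet [n] ∖ X and followed
-- by X in decreasing order lies in D_n^+(S): by maximality of i, the junction position
-- n-i-1 is not in S.
module Submission where

open import Defs

open import Data.Bool using (true; false; if_then_else_)
open import Data.Empty using (⊥-elim)
open import Data.Fin using (Fin; toℕ; fromℕ<) renaming (zero to fzero; suc to fsuc)
open import Data.Fin.Properties using (toℕ<n; toℕ-fromℕ<; toℕ-injective)
open import Data.Fin.Subset using (Subset) renaming (∣_∣ to size)
open import Data.Fin.Subset.Properties using (∣p∣≤n)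
open import Data.Integer as ℤ using (ℤ; +_; -_; 0ℤ; +[1+_]; -[1+_]; ∣_∣)
import Data.Integer.Properties as ℤP
open import Data.List using (List; []; _∷_; length; filter; map; upTo; take; drop; _++_; cartesianProduct)
import Data.List.Properties as LP
open import Data.List.Membership.Propositional using (_∈_)
import Data.List.Membership.Propositional.Properties as MP
open import Data.List.Relation.Binary.Permutation.Propositional
  using (_↭_; prep; ↭-trans; ↭-sym; ↭-reflexive; ↭-refl; ↭⇒↭ₛ; module PermutationReasoning)
import Data.List.Relation.Binary.Permutation.Propositional.Properties as PermP
import Data.List.Relation.Binary.Permutation.Setoid.Properties as PermSetoid
open import Data.List.Relation.Unary.All using (All; []; _∷_)
import Data.List.Relation.Unary.All as All
import Data.List.Relation.Unary.All.Properties as AllP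
open import Data.List.Relation.Unary.AllPairs using (AllPairs; []; _∷_)
import Data.List.Relation.Unary.AllPairs as AllPairs
import Data.List.Relation.Unary.AllPairs.Properties as AllPairsP
open import Data.List.Relation.Unary.Any using (Any; here; there; any?)
import Data.List.Relation.Unary.Any as Any
open import Data.List.Relation.Unary.Linked using (Linked; []; [-]; _∷_)
import Data.List.Relation.Unary.Linked.Properties as LinkedP
open import Data.List.Relation.Unary.Unique.Propositional using (Unique)
import Data.List.Relation.Unary.Unique.Propositional.Properties as UniqueP
open import Data.Nat as ℕ using (ℕ; zero; suc; _∸_; _+_; _*_; _≤_; _<_; z≤n; s≤s; _<?_)
open import Data.Nat.Combinatorics using (_C_; nCk+nC[k+1]≡[n+1]C[k+1])
open import Data.Nat.Divisibility using (_∣_; ∣1⇒≡1)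
import Data.Nat.Properties as ℕP
open import Data.Product using (Σ; _×_; _,_; proj₁; proj₂)
open import Data.Sum using (inj₁; inj₂)
open import Data.Vec using (lookup; tabulate) renaming ([] to []ᵥ; _∷_ to _∷ᵥ_)
open import Data.Vec.Properties using (lookup∘tabulate; tabulate∘lookup; tabulate-cong; ∷-injectiveʳ)
open import Function using (_∘_)
open import Relation.Binary.Definitions using (tri<; tri≈; tri>)
open import Relation.Binary.PropositionalEquality
  using (_≡_; _≢_; refl; sym; trans; cong; cong₂; subst; subst₂; setoid; module ≡-Reasoning)
open import Relation.Nullary using (does; ¬_; yes; no; Dec)
open import Relation.Nullary.Decidable using (dec-true; dec-false)
open import Relation.Unary using (_⟨×⟩_)

-- The local helper of sst in Defs.
signed : ℤ → ℕ → ℤ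
signed a r = if does (0ℤ ℤ.<? a) then + r else - (+ r)

∣signed∣ : ∀ a r → ∣ signed a r ∣ ≡ r
∣signed∣ (+ zero)  r       = ℤP.∣-i∣≡∣i∣ (+ r)
∣signed∣ +[1+ _ ]  r       = refl
∣signed∣ -[1+ _ ]  zero    = refl
∣signed∣ -[1+ _ ]  (suc r) = refl

signed-neg : ∀ {a} r → a ≢ 0ℤ → signed (- a) r ≡ - signed a r
signed-neg {+ zero}    r a≢0 = ⊥-elim (a≢0 refl)
signed-neg {+[1+ _ ]}  r _   = refl
signed-neg { -[1+ _ ]} r _   = sym (ℤP.neg-involutive (+ r))

signed<0⇒<0 : ∀ {a} r → a ≢ 0ℤ → signed a r ℤ.< 0ℤ → a ℤ.< 0ℤ
signed<0⇒<0 {+ zero}    r a≢0 _          = ⊥-elim (a≢0 refl)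
signed<0⇒<0 {+[1+ _ ]}  r _   (ℤ.+<+ ())
signed<0⇒<0 { -[1+ _ ]} r _   _          = ℤ.-<+

<0⇒signed<0 : ∀ {a r} → 1 ≤ r → a ℤ.< 0ℤ → signed a r ℤ.< 0ℤ
<0⇒signed<0 { -[1+ _ ]} {suc _} _ _          = ℤ.-<+
<0⇒signed<0 {+ _}       {suc _} _ (ℤ.+<+ ())

signed-signed : ∀ {a r} → 1 ≤ r → a ≢ 0ℤ → signed (signed a r) ∣ a ∣ ≡ a
signed-signed {+ zero}            _ a≢0 = ⊥-elim (a≢0 refl)
signed-signed {+[1+ _ ]}  {suc _} _ _   = refl
signed-signed { -[1+ _ ]} {suc _} _ _   = refl

signed-injective : ∀ {a b r} → 1 ≤ r → a ≢ 0ℤ → b ≢ 0ℤ →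
                   signed a r ≡ signed b r → ∣ a ∣ ≡ ∣ b ∣ → a ≡ b
signed-injective {+ zero}                         _ a≢0 _   _  _ = ⊥-elim (a≢0 refl)
signed-injective {_}         {+ zero}             _ _   b≢0 _  _ = ⊥-elim (b≢0 refl)
signed-injective {+[1+ _ ]}  {+[1+ _ ]}           _ _   _   _  e = cong +_ e
signed-injective { -[1+ _ ]} { -[1+ _ ]}          _ _   _   _  e = cong -[1+_] (ℕP.suc-injective e)
signed-injective {+[1+ _ ]}  { -[1+ _ ]} {suc _}  _ _   _   () _
signed-injective { -[1+ _ ]} {+[1+ _ ]}  {suc _}  _ _   _   () _

signed-mono-< : ∀ {a b ra rb} → a ≢ 0ℤ → b ≢ 0ℤ → 1 ≤ ra → 1 ≤ rb →
                (∣ b ∣ < ∣ a ∣ → rb < ra) → (∣ a ∣ < ∣ b ∣ → ra < rb) →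
                b ℤ.< a → signed b rb ℤ.< signed a ra
signed-mono-< {+ zero}         a≢0 _   _ _ _  _  _           = ⊥-elim (a≢0 refl)
signed-mono-< {_} {+ zero}     _   b≢0 _ _ _  _  _           = ⊥-elim (b≢0 refl)
signed-mono-< {+[1+ _ ]}  {+[1+ _ ]}                  _ _ _ _ ba _  (ℤ.+<+ b<a) = ℤ.+<+ (ba b<a)
signed-mono-< {+[1+ _ ]}  { -[1+ _ ]} {rb = suc _}    _ _ _ _ _  _  _           = ℤ.-<+
signed-mono-< { -[1+ _ ]} {+[1+ _ ]}                  _ _ _ _ _  _  ()
signed-mono-< { -[1+ _ ]} { -[1+ _ ]} {suc _} {suc _} _ _ _ _ _  ab (ℤ.-<- a<b) =
  ℤ.-<- (ℕP.≤-pred (ab (s≤s a<b)))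

+<0⇒<- : ∀ a b → a ℤ.+ b ℤ.< 0ℤ → a ℤ.< - b
+<0⇒<- a b a+b<0 = subst₂ ℤ._<_ a+b-b≡a (ℤP.+-identityˡ (- b)) (ℤP.+-monoˡ-< (- b) a+b<0)
  where
  open ≡-Reasoning
  a+b-b≡a : (a ℤ.+ b) ℤ.+ - b ≡ a
  a+b-b≡a = begin
    (a ℤ.+ b) ℤ.+ - b  ≡⟨ ℤP.+-assoc a b (- b) ⟩
    a ℤ.+ (b ℤ.+ - b)  ≡⟨ cong (λ z → a ℤ.+ z) (ℤP.+-inverseʳ b) ⟩
    a ℤ.+ 0ℤ           ≡⟨ ℤP.+-identityʳ a ⟩
    a                  ∎

<-⇒+<0 : ∀ a b → a ℤ.< - b → a ℤ.+ b ℤ.< 0ℤ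
<-⇒+<0 a b a<-b = subst (a ℤ.+ b ℤ.<_) (ℤP.+-inverseˡ b) (ℤP.+-monoˡ-< b a<-b)

relabel : (ℕ → ℕ) → ℤ → ℤ
relabel R a = signed a (R ∣ a ∣)

record MonotoneAt (R : ℕ → ℕ) (a b : ℤ) : Set where
  field
    a≢0   : a ≢ 0ℤ
    b≢0   : b ≢ 0ℤ
    1≤Ra  : 1 ≤ R ∣ a ∣
    1≤Rb  : 1 ≤ R ∣ b ∣
    mono  : ∣ a ∣ < ∣ b ∣ → R ∣ a ∣ < R ∣ b ∣
    mono′ : ∣ b ∣ < ∣ a ∣ → R ∣ b ∣ < R ∣ a ∣

relabel-mono-< : ∀ {R a b} → MonotoneAt R a b → b ℤ.< a → relabel R b ℤ.< relabel R a
relabel-mono-< m = signed-mono-< a≢0 b≢0 1≤Ra 1≤Rb mono′ mono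
  where open MonotoneAt m

relabel-mono-≤ : ∀ {R a b} → MonotoneAt R a b → b ℤ.≤ a → relabel R b ℤ.≤ relabel R a
relabel-mono-≤ {a = a} {b} m b≤a with b ℤ.≟ a
... | yes refl = ℤP.≤-refl
... | no b≢a   = ℤP.<⇒≤ (relabel-mono-< m (ℤP.≤∧≢⇒< b≤a b≢a))

-- relabel R is odd, so it preserves a < - b, i.e. a + b < 0.
relabel-+<0 : ∀ {R a b} → MonotoneAt R a b → a ℤ.+ b ℤ.< 0ℤ → relabel R a ℤ.+ relabel R b ℤ.< 0ℤ
relabel-+<0 {R} {a} {b} m a+b<0 =
  <-⇒+<0 (relabel R a) (relabel R b)
    (subst (relabel R a ℤ.<_) relabel-neg (relabel-mono-< m⁻ (+<0⇒<- a b a+b<0)))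
  where
  open MonotoneAt m
  ∣-b∣≡∣b∣ : ∣ - b ∣ ≡ ∣ b ∣
  ∣-b∣≡∣b∣ = ℤP.∣-i∣≡∣i∣ b
  relabel-neg : relabel R (- b) ≡ - relabel R b
  relabel-neg = trans (cong (λ z → signed (- b) (R z)) ∣-b∣≡∣b∣) (signed-neg (R ∣ b ∣) b≢0)
  m⁻ : MonotoneAt R (- b) a
  m⁻ = record
    { a≢0   = λ -b≡0 → b≢0 (trans (sym (ℤP.neg-involutive b)) (cong -_ -b≡0))
    ; b≢0   = a≢0
    ; 1≤Ra  = subst (λ z → 1 ≤ R z) (sym ∣-b∣≡∣b∣) 1≤Rb
    ; 1≤Rb  = 1≤Ra
    ; mono  = λ lt → subst (λ z → R z < R ∣ a ∣) (sym ∣-b∣≡∣b∣) (mono′ (subst (_< ∣ a ∣) ∣-b∣≡∣b∣ lt))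
    ; mono′ = λ lt → subst (λ z → R ∣ a ∣ < R z) (sym ∣-b∣≡∣b∣) (mono (subst (∣ a ∣ <_) ∣-b∣≡∣b∣ lt))
    }

ent-∷ : ∀ a w {m} → 1 ≤ m → ent (a ∷ w) (suc m) ≡ ent w m
ent-∷ a w {suc m} _ = refl

ent-++ˡ : ∀ u t j → suc j ≤ length u → ent (u ++ t) (suc j) ≡ ent u (suc j)
ent-++ˡ (a ∷ u) t zero    _       = refl
ent-++ˡ (a ∷ u) t (suc j) (s≤s p) = ent-++ˡ u t j p

ent-++ʳ : ∀ u t j → ent (u ++ t) (length u + suc j) ≡ ent t (suc j)
ent-++ʳ []      t j = refl
ent-++ʳ (a ∷ u) t j =
  trans (ent-∷ a (u ++ t) (ℕP.≤-trans (s≤s z≤n) (ℕP.m≤n+m (suc j) (length u)))) (ent-++ʳ u t j)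

ent-map : ∀ (f : ℤ → ℤ) u j → suc j ≤ length u → ent (map f u) (suc j) ≡ f (ent u (suc j))
ent-map f (a ∷ u) zero    _       = refl
ent-map f (a ∷ u) (suc j) (s≤s p) = ent-map f u j p

ent∈ : ∀ u j → suc j ≤ length u → ent u (suc j) ∈ u
ent∈ (a ∷ u) zero    _       = here refl
ent∈ (a ∷ u) (suc j) (s≤s p) = there (ent∈ u j p)

Linked-fromEnt : ∀ {R : ℤ → ℤ → Set} t →
                 (∀ j → suc j < length t → R (ent t (suc j)) (ent t (suc (suc j)))) → Linked R t
Linked-fromEnt []          _ = []
Linked-fromEnt (a ∷ [])    _ = [-]
Linked-fromEnt (a ∷ b ∷ t) f = f 0 (s≤s (s≤s z≤n)) ∷ Linked-fromEnt (b ∷ t) (λ j p → f (suc j) (s≤s p))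

Linked-ent : ∀ {R : ℤ → ℤ → Set} t → Linked R t →
             ∀ j → suc j < length t → R (ent t (suc j)) (ent t (suc (suc j)))
Linked-ent (a ∷ [])    [-]     j       (s≤s ())
Linked-ent (a ∷ b ∷ t) (r ∷ l) zero    _       = r
Linked-ent (a ∷ b ∷ t) (r ∷ l) (suc j) (s≤s p) = Linked-ent (b ∷ t) l j p

count : ∀ {A : Set} {P : A → Set} → ((x : A) → Dec (P x)) → List A → ℕ
count P? xs = length (filter P? xs)

module _ {A : Set} {P : A → Set} (P? : (x : A) → Dec (P x)) where

  count-++ : ∀ xs ys → count P? (xs ++ ys) ≡ count P? xs + count P? ys
  count-++ xs ys = trans (cong length (LP.filter-++ P? xs ys)) (LP.length-++ (filter P? xs))

  count-none : ∀ {xs} → All (λ x → ¬ P x) xs → count P? xs ≡ 0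
  count-none none = cong length (LP.filter-none P? none)

  count-accept : ∀ {x} xs → P x → count P? (x ∷ xs) ≡ suc (count P? xs)
  count-accept xs px = cong length (LP.filter-accept P? px)

  count-reject : ∀ {x} xs → ¬ P x → count P? (x ∷ xs) ≡ count P? xs
  count-reject xs ¬px = cong length (LP.filter-reject P? ¬px)

  count-↭ : ∀ {xs ys} → xs ↭ ys → count P? xs ≡ count P? ys
  count-↭ p = PermP.↭-length (PermP.filter-↭ P? p)

  module _ {Q : A → Set} (Q? : (x : A) → Dec (Q x)) where

    count-cong : ∀ xs → (∀ {a} → a ∈ xs → (P a → Q a) × (Q a → P a)) → count P? xs ≡ count Q? xs
    count-cong []       _ = refl
    count-cong (x ∷ xs) f with P? x | Q? x
    ... | yes _  | yes _  = cong suc (count-cong xs (f ∘ there))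
    ... | no _   | no _   = count-cong xs (f ∘ there)
    ... | yes p  | no ¬q  = ⊥-elim (¬q (proj₁ (f (here refl)) p))
    ... | no ¬p  | yes q  = ⊥-elim (¬p (proj₂ (f (here refl)) q))

    count-mono-≤ : ∀ xs → (∀ {a} → a ∈ xs → P a → Q a) → count P? xs ≤ count Q? xs
    count-mono-≤ []       _ = z≤n
    count-mono-≤ (x ∷ xs) f with P? x | Q? x
    ... | yes _  | yes _  = s≤s (count-mono-≤ xs (f ∘ there))
    ... | no _   | no _   = count-mono-≤ xs (f ∘ there)
    ... | yes p  | no ¬q  = ⊥-elim (¬q (f (here refl) p))
    ... | no _   | yes _  = ℕP.m≤n⇒m≤1+n (count-mono-≤ xs (f ∘ there))

    count-mono-< : ∀ xs → (∀ {a} → a ∈ xs → P a → Q a) →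
                   ∀ {b} → b ∈ xs → Q b → ¬ P b → count P? xs < count Q? xs
    count-mono-< (x ∷ xs) f (here refl) qb ¬pb with P? x | Q? x
    ... | yes p | _     = ⊥-elim (¬pb p)
    ... | no _  | no ¬q = ⊥-elim (¬q qb)
    ... | no _  | yes _ = s≤s (count-mono-≤ xs (f ∘ there))
    count-mono-< (x ∷ xs) f (there b∈) qb ¬pb with P? x | Q? x
    ... | yes _ | yes _ = s≤s (count-mono-< xs (f ∘ there) b∈ qb ¬pb)
    ... | no _  | no _  = count-mono-< xs (f ∘ there) b∈ qb ¬pb
    ... | yes p | no ¬q = ⊥-elim (¬q (f (here refl) p))
    ... | no _  | yes _ = ℕP.m≤n⇒m≤1+n (count-mono-< xs (f ∘ there) b∈ qb ¬pb)

count-map : ∀ {A B : Set} {P : B → Set} (P? : (x : B) → Dec (P x)) (f : A → B) xs →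
            count P? (map f xs) ≡ count (λ x → P? (f x)) xs
count-map P? f []       = refl
count-map P? f (x ∷ xs) with P? (f x)
... | yes _ = cong suc (count-map P? f xs)
... | no _  = count-map P? f xs

oneTo : ℕ → List ℕ
oneTo n = map suc (upTo n)

upTo-suc : ∀ n → upTo (suc n) ≡ 0 ∷ map suc (upTo n)
upTo-suc n = cong (0 ∷_) (sym (LP.map-upTo suc n))

oneTo-suc : ∀ n → oneTo (suc n) ≡ 1 ∷ map suc (oneTo n)
oneTo-suc n = cong (map suc) (upTo-suc n)

length-oneTo : ∀ n → length (oneTo n) ≡ n
length-oneTo n = trans (LP.length-map suc (upTo n)) (LP.length-upTo n)

∈-oneTo⁻ : ∀ {m k} → m ∈ oneTo k → Σ ℕ (λ m′ → (m ≡ suc m′) × (m′ < k))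
∈-oneTo⁻ m∈ with MP.∈-map⁻ suc m∈
... | m′ , m′∈ , refl = m′ , refl , MP.∈-upTo⁻ m′∈

∣∣∈oneTo⇒≢0 : ∀ {a k} → ∣ a ∣ ∈ oneTo k → a ≢ 0ℤ
∣∣∈oneTo⇒≢0 a∈ refl with ∈-oneTo⁻ a∈
... | _ , () , _

rank : List ℕ → ℕ → ℕ
rank L m = count (_<? m) L

rank-mono-< : ∀ L {m m′} → m ∈ L → m < m′ → rank L m < rank L m′
rank-mono-< L {m} {m′} m∈ m<m′ =
  count-mono-< (_<? m) (_<? m′) L (λ _ y<m → ℕP.<-trans y<m m<m′) m∈ m<m′ (ℕP.<-irrefl refl)

rank-↭ : ∀ {L L′} → L ↭ L′ → ∀ m → rank L m ≡ rank L′ m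
rank-↭ p m = count-↭ (_<? m) p

rank-map-suc : ∀ L r → rank (map suc L) (suc r) ≡ rank L r
rank-map-suc L r = trans (count-map (_<? suc r) suc L)
  (count-cong (λ y → suc y <? suc r) (_<? r) L (λ _ → ℕP.≤-pred , s≤s))

rank-oneTo : ∀ k {m} → m ≤ k → rank (oneTo k) (suc m) ≡ m
rank-oneTo zero    {zero}  _ = refl
rank-oneTo (suc k) {zero}  _ = trans (cong (λ L → rank L 1) (oneTo-suc k))
  (count-none (_<? 1) {map suc (oneTo k)} (AllP.map⁺ {f = suc} (All.tabulate (λ _ → λ { (s≤s ()) }))))
rank-oneTo (suc k) {suc m} (s≤s m≤k) = trans (cong (λ L → rank L (suc (suc m))) (oneTo-suc k))
  (cong suc (trans (rank-map-suc (oneTo k) (suc m)) (rank-oneTo k m≤k)))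

map-rank-sorted : ∀ L → AllPairs _<_ L → map (rank L) L ≡ upTo (length L)
map-rank-sorted []      _           = refl
map-rank-sorted (x ∷ L) (x<L ∷ L↑) =
  trans (cong₂ _∷_ rank-x (trans (LP.map-cong-local rank-L) (trans (LP.map-∘ L) (cong (map suc) (map-rank-sorted L L↑)))))
        (sym (upTo-suc (length L)))
  where
  rank-x : rank (x ∷ L) x ≡ 0
  rank-x = trans (count-reject (_<? x) L (ℕP.<-irrefl refl))
                 (count-none (_<? x) (All.map (λ x<y y<x → ℕP.<-asym x<y y<x) x<L))
  rank-L : All (λ y → rank (x ∷ L) y ≡ suc (rank L y)) L
  rank-L = All.map (λ {y} x<y → count-accept (_<? y) L x<y) x<L

map-rank-↭ : ∀ {A B} → A ↭ B → AllPairs _<_ B → map (λ m → suc (rank A m)) A ↭ oneTo (length A)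
map-rank-↭ {A} {B} A↭B B↑ = ↭-trans (PermP.map⁺ _ A↭B) (↭-reflexive (begin
  map (λ m → suc (rank A m)) B  ≡⟨ LP.map-cong (λ m → cong suc (rank-↭ A↭B m)) B ⟩
  map (λ m → suc (rank B m)) B  ≡⟨ LP.map-∘ B ⟩
  map suc (map (rank B) B)      ≡⟨ cong (map suc) (map-rank-sorted B B↑) ⟩
  oneTo (length B)              ≡⟨ cong oneTo (sym (PermP.↭-length A↭B)) ⟩
  oneTo (length A)              ∎))
  where open ≡-Reasoning

-- Element f of a Subset n stands for the value f + 1, as in valueSet.
elemsDesc : ∀ {n} → Subset n → List ℕ
elemsDesc []ᵥ          = []
elemsDesc (true ∷ᵥ X)  = map suc (elemsDesc X) ++ 1 ∷ []
elemsDesc (false ∷ᵥ X) = map suc (elemsDesc X)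

nonElemsAsc : ∀ {n} → Subset n → List ℕ
nonElemsAsc []ᵥ          = []
nonElemsAsc (true ∷ᵥ X)  = map suc (nonElemsAsc X)
nonElemsAsc (false ∷ᵥ X) = 1 ∷ map suc (nonElemsAsc X)

length-elemsDesc : ∀ {n} (X : Subset n) → length (elemsDesc X) ≡ size X
length-elemsDesc []ᵥ          = refl
length-elemsDesc (true ∷ᵥ X)  = trans (LP.length-++ (map suc (elemsDesc X)))
  (trans (ℕP.+-comm _ 1) (cong suc (trans (LP.length-map suc (elemsDesc X)) (length-elemsDesc X))))
length-elemsDesc (false ∷ᵥ X) = trans (LP.length-map suc (elemsDesc X)) (length-elemsDesc X)

length-nonElemsAsc : ∀ {n} (X : Subset n) → length (nonElemsAsc X) + size X ≡ n
length-nonElemsAsc []ᵥ          = refl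
length-nonElemsAsc (true ∷ᵥ X)  = trans (ℕP.+-suc _ (size X))
  (cong suc (trans (cong (_+ size X) (LP.length-map suc (nonElemsAsc X))) (length-nonElemsAsc X)))
length-nonElemsAsc (false ∷ᵥ X) =
  cong suc (trans (cong (_+ size X) (LP.length-map suc (nonElemsAsc X))) (length-nonElemsAsc X))

private
  ∈-map-suc⁻ : ∀ {m xs} → m ∈ map suc xs → Σ ℕ (λ m′ → (m ≡ suc m′) × (m′ ∈ xs))
  ∈-map-suc⁻ m∈ with MP.∈-map⁻ suc m∈
  ... | m′ , m′∈ , refl = m′ , refl , m′∈

∈-elemsDesc⁻ : ∀ {n} (X : Subset n) {m} → m ∈ elemsDesc X →
               Σ (Fin n) (λ f → (m ≡ suc (toℕ f)) × (lookup X f ≡ true))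
∈-elemsDesc⁻ (true ∷ᵥ X) m∈ with MP.∈-++⁻ (map suc (elemsDesc X)) m∈
... | inj₂ (here refl) = fzero , refl , refl
... | inj₁ m∈′ with ∈-map-suc⁻ m∈′
... | m′ , refl , m′∈ with ∈-elemsDesc⁻ X m′∈
... | f , e , Xf = fsuc f , cong suc e , Xf
∈-elemsDesc⁻ (false ∷ᵥ X) m∈ with ∈-map-suc⁻ m∈
... | m′ , refl , m′∈ with ∈-elemsDesc⁻ X m′∈
... | f , e , Xf = fsuc f , cong suc e , Xf

∈-elemsDesc⁺ : ∀ {n} (X : Subset n) f → lookup X f ≡ true → suc (toℕ f) ∈ elemsDesc X
∈-elemsDesc⁺ (true ∷ᵥ X)  fzero    refl = MP.∈-++⁺ʳ (map suc (elemsDesc X)) (here refl)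
∈-elemsDesc⁺ (true ∷ᵥ X)  (fsuc f) Xf   = MP.∈-++⁺ˡ (MP.∈-map⁺ suc (∈-elemsDesc⁺ X f Xf))
∈-elemsDesc⁺ (false ∷ᵥ X) (fsuc f) Xf   = MP.∈-map⁺ suc (∈-elemsDesc⁺ X f Xf)

∈-nonElemsAsc⁻ : ∀ {n} (X : Subset n) {m} → m ∈ nonElemsAsc X →
                 Σ (Fin n) (λ f → (m ≡ suc (toℕ f)) × (lookup X f ≡ false))
∈-nonElemsAsc⁻ (false ∷ᵥ X) (here refl) = fzero , refl , refl
∈-nonElemsAsc⁻ (false ∷ᵥ X) (there m∈) with ∈-map-suc⁻ m∈
... | m′ , refl , m′∈ with ∈-nonElemsAsc⁻ X m′∈
... | f , e , Xf = fsuc f , cong suc e , Xf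
∈-nonElemsAsc⁻ (true ∷ᵥ X) m∈ with ∈-map-suc⁻ m∈
... | m′ , refl , m′∈ with ∈-nonElemsAsc⁻ X m′∈
... | f , e , Xf = fsuc f , cong suc e , Xf

∈-elemsDesc⇒1≤ : ∀ {n} (X : Subset n) {m} → m ∈ elemsDesc X → 1 ≤ m
∈-elemsDesc⇒1≤ X m∈ with ∈-elemsDesc⁻ X m∈
... | _ , refl , _ = s≤s z≤n

∈-nonElemsAsc⇒1≤ : ∀ {n} (X : Subset n) {m} → m ∈ nonElemsAsc X → 1 ≤ m
∈-nonElemsAsc⇒1≤ X m∈ with ∈-nonElemsAsc⁻ X m∈
... | _ , refl , _ = s≤s z≤n

elemsDesc-decreasing : ∀ {n} (X : Subset n) → AllPairs (λ x y → y < x) (elemsDesc X)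
elemsDesc-decreasing []ᵥ          = []
elemsDesc-decreasing (true ∷ᵥ X)  =
  AllPairsP.++⁺ (AllPairsP.map⁺ (AllPairs.map s≤s (elemsDesc-decreasing X))) ([] ∷ [])
    (AllP.map⁺ (All.tabulate (λ x∈ → s≤s (∈-elemsDesc⇒1≤ X x∈) ∷ [])))
elemsDesc-decreasing (false ∷ᵥ X) = AllPairsP.map⁺ (AllPairs.map s≤s (elemsDesc-decreasing X))

nonElemsAsc-increasing : ∀ {n} (X : Subset n) → AllPairs _<_ (nonElemsAsc X)
nonElemsAsc-increasing []ᵥ          = []
nonElemsAsc-increasing (true ∷ᵥ X)  = AllPairsP.map⁺ (AllPairs.map s≤s (nonElemsAsc-increasing X))
nonElemsAsc-increasing (false ∷ᵥ X) =
  AllP.map⁺ (All.tabulate (λ x∈ → s≤s (∈-nonElemsAsc⇒1≤ X x∈)))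
    ∷ AllPairsP.map⁺ (AllPairs.map s≤s (nonElemsAsc-increasing X))

nonElemsAsc++elemsDesc↭oneTo : ∀ {n} (X : Subset n) → nonElemsAsc X ++ elemsDesc X ↭ oneTo n
nonElemsAsc++elemsDesc↭oneTo []ᵥ = ↭-refl
nonElemsAsc++elemsDesc↭oneTo {suc n} (false ∷ᵥ X) = begin
  1 ∷ map suc (nonElemsAsc X) ++ map suc (elemsDesc X)  ≡⟨ cong (1 ∷_) (sym (LP.map-++ suc (nonElemsAsc X) (elemsDesc X))) ⟩
  1 ∷ map suc (nonElemsAsc X ++ elemsDesc X)            ↭⟨ prep 1 (PermP.map⁺ suc (nonElemsAsc++elemsDesc↭oneTo X)) ⟩
  1 ∷ map suc (oneTo n)                                  ≡⟨ oneTo-suc n ⟨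
  oneTo (suc n)                                          ∎
  where open PermutationReasoning
nonElemsAsc++elemsDesc↭oneTo {suc n} (true ∷ᵥ X) = begin
  map suc (nonElemsAsc X) ++ (map suc (elemsDesc X) ++ 1 ∷ [])  ≡⟨ LP.++-assoc (map suc (nonElemsAsc X)) _ _ ⟨
  (map suc (nonElemsAsc X) ++ map suc (elemsDesc X)) ++ 1 ∷ []  ↭⟨ PermP.shift 1 (map suc (nonElemsAsc X) ++ map suc (elemsDesc X)) [] ⟩
  1 ∷ (map suc (nonElemsAsc X) ++ map suc (elemsDesc X)) ++ []  ≡⟨ cong (1 ∷_) (LP.++-identityʳ _) ⟩
  1 ∷ map suc (nonElemsAsc X) ++ map suc (elemsDesc X)          ≡⟨ cong (1 ∷_) (sym (LP.map-++ suc (nonElemsAsc X) (elemsDesc X))) ⟩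
  1 ∷ map suc (nonElemsAsc X ++ elemsDesc X)                    ↭⟨ prep 1 (PermP.map⁺ suc (nonElemsAsc++elemsDesc↭oneTo X)) ⟩
  1 ∷ map suc (oneTo n)                                          ≡⟨ oneTo-suc n ⟨
  oneTo (suc n)                                                  ∎
  where open PermutationReasoning

Linked-≥⇒All-pos : ∀ t → Linked ℤ._≥_ t → 0ℤ ℤ.< ent t (length t) → All (0ℤ ℤ.<_) t
Linked-≥⇒All-pos []          _       (ℤ.+<+ ())
Linked-≥⇒All-pos (a ∷ [])    _       0<a = 0<a ∷ []
Linked-≥⇒All-pos (a ∷ b ∷ t) (a≥b ∷ l) 0<last with Linked-≥⇒All-pos (b ∷ t) l 0<last
... | 0<b ∷ rest = ℤP.<-≤-trans 0<b a≥b ∷ 0<b ∷ rest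

Linked-≥∧Unique⇒AllPairs-> : ∀ {t} → Linked ℤ._≥_ t → Unique t → AllPairs ℤ._>_ t
Linked-≥∧Unique⇒AllPairs-> l u = LinkedP.Linked⇒AllPairs (λ p q → ℤP.<-trans q p) (strict l u)
  where
  strict : ∀ {t} → Linked ℤ._≥_ t → Unique t → Linked ℤ._>_ t
  strict []        _                 = []
  strict [-]       _                 = [-]
  strict (a≥b ∷ l) ((a≢b ∷ _) ∷ u) = ℤP.≤∧≢⇒< a≥b (λ b≡a → a≢b (sym b≡a)) ∷ strict l u

AllPairs->⇒Linked-≥ : ∀ {t} → AllPairs ℤ._>_ t → Linked ℤ._≥_ t
AllPairs->⇒Linked-≥ ap = LinkedP.AllPairs⇒Linked (AllPairs.map ℤP.<⇒≤ ap)

AllPairs->-≡ : ∀ {xs ys} → AllPairs ℤ._>_ xs → AllPairs ℤ._>_ ys →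
               (∀ {a} → a ∈ xs → a ∈ ys) → (∀ {a} → a ∈ ys → a ∈ xs) → xs ≡ ys
AllPairs->-≡ {[]}     {[]}     _ _ _ _ = refl
AllPairs->-≡ {[]}     {y ∷ ys} _ _ _ g with g (here refl)
... | ()
AllPairs->-≡ {x ∷ xs} {[]}     _ _ f _ with f (here refl)
... | ()
AllPairs->-≡ {x ∷ xs} {y ∷ ys} (x>xs ∷ xs↓) (y>ys ∷ ys↓) f g =
  cong₂ _∷_ x≡y (AllPairs->-≡ xs↓ ys↓ f′ g′)
  where
  x≡y : x ≡ y
  x≡y with f (here refl) | g (here refl)
  ... | here x≡y  | _         = x≡y
  ... | there _   | here y≡x  = sym y≡x
  ... | there x∈ | there y∈ = ⊥-elim (ℤP.<-asym (All.lookup y>ys x∈) (All.lookup x>xs y∈))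
  f′ : ∀ {a} → a ∈ xs → a ∈ ys
  f′ a∈ with f (there a∈)
  ... | there a∈′ = a∈′
  ... | here refl = ⊥-elim (ℤP.<-irrefl (sym x≡y) (All.lookup x>xs a∈))
  g′ : ∀ {a} → a ∈ ys → a ∈ xs
  g′ a∈ with g (there a∈)
  ... | there a∈′ = a∈′
  ... | here refl = ⊥-elim (ℤP.<-irrefl x≡y (All.lookup y>ys a∈))

memberSet : (n : ℕ) → List ℤ → Subset n
memberSet n t = tabulate (λ f → does (any? (λ a → a ℤP.≟ + suc (toℕ f)) t))

memberSet-elemsDesc : ∀ {n} (X : Subset n) → memberSet n (map +_ (elemsDesc X)) ≡ X
memberSet-elemsDesc {n} X = trans (tabulate-cong same) (tabulate∘lookup X)
  where
  same : ∀ f → does (any? (λ a → a ℤP.≟ + suc (toℕ f)) (map +_ (elemsDesc X))) ≡ lookup X f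
  same f with lookup X f in Xf
  ... | true  = dec-true (any? _ _) (Any.map sym (MP.∈-map⁺ +_ (∈-elemsDesc⁺ X f Xf)))
  ... | false = dec-false (any? _ _) absent
    where
    absent : ¬ Any (_≡ + suc (toℕ f)) (map +_ (elemsDesc X))
    absent hit with MP.∈-map⁻ +_ (Any.map sym hit)
    ... | m , m∈ , e with ∈-elemsDesc⁻ X m∈
    ... | f′ , refl , Xf′ with toℕ-injective (ℕP.suc-injective (ℤP.+-injective e))
    ... | refl with () ← trans (sym Xf) Xf′

lookup-memberSet⇒∈ : ∀ {n} t (f : Fin n) → lookup (memberSet n t) f ≡ true → + suc (toℕ f) ∈ t
lookup-memberSet⇒∈ {n} t f Vf = Any.map sym (witness (any? _ t) (trans (sym (lookup∘tabulate _ f)) Vf))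
  where
  witness : ∀ {P : Set} (d : Dec P) → does d ≡ true → P
  witness (yes p) _ = p

AllPairs->⇒≡elemsDesc-memberSet : ∀ {n t} → AllPairs ℤ._>_ t → All (0ℤ ℤ.<_) t →
                                  (∀ {a} → a ∈ t → ∣ a ∣ ∈ oneTo n) →
                                  t ≡ map +_ (elemsDesc (memberSet n t))
AllPairs->⇒≡elemsDesc-memberSet {n} {t} t↓ t>0 t⊆[1,n] = AllPairs->-≡ t↓ V↓ ⊆V V⊆
  where
  V = memberSet n t
  V↓ : AllPairs ℤ._>_ (map +_ (elemsDesc V))
  V↓ = AllPairsP.map⁺ (AllPairs.map ℤ.+<+ (elemsDesc-decreasing V))
  ⊆V : ∀ {a} → a ∈ t → a ∈ map +_ (elemsDesc V)
  ⊆V {a} a∈ with ∈-oneTo⁻ (t⊆[1,n] a∈) | All.lookup t>0 a∈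
  ⊆V {+ _} a∈ | m , refl , m<n | _ =
    subst (λ z → + suc z ∈ map +_ (elemsDesc V)) (toℕ-fromℕ< m<n)
      (MP.∈-map⁺ +_ (∈-elemsDesc⁺ V f (trans (lookup∘tabulate _ f) (dec-true (any? _ t) (Any.map (λ e → trans (sym e) a≡) a∈)))))
    where
    f = fromℕ< m<n
    a≡ : + suc m ≡ + suc (toℕ f)
    a≡ = cong (λ z → + suc z) (sym (toℕ-fromℕ< m<n))
  V⊆ : ∀ {a} → a ∈ map +_ (elemsDesc V) → a ∈ t
  V⊆ a∈ with MP.∈-map⁻ +_ a∈
  ... | m , m∈ , refl with ∈-elemsDesc⁻ V m∈
  ... | f , refl , Vf = lookup-memberSet⇒∈ t f Vf

-- By definition sst w ≡ map (relabel (stRank w)) w.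
stRank : List ℤ → ℕ → ℕ
stRank w m = suc (length (filter (λ b → ∣ b ∣ <? m) w))

stRank≡suc-rank : ∀ w m → stRank w m ≡ suc (rank (map ∣_∣ w) m)
stRank≡suc-rank w m = cong suc (sym (count-map (_<? m) ∣_∣ w))

∣∣-map-relabel : ∀ R w → map ∣_∣ (map (relabel R) w) ≡ map R (map ∣_∣ w)
∣∣-map-relabel R w = trans (sym (LP.map-∘ w)) (trans (LP.map-cong (λ a → ∣signed∣ a (R ∣ a ∣)) w) (LP.map-∘ w))

negCount-map-relabel : ∀ R w → (∀ {a} → a ∈ w → a ≢ 0ℤ × 1 ≤ R ∣ a ∣) →
                       negCount (map (relabel R) w) ≡ negCount w
negCount-map-relabel R w ok = trans (count-map (ℤ._<? 0ℤ) (relabel R) w)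
  (count-cong (λ a → relabel R a ℤ.<? 0ℤ) (ℤ._<? 0ℤ) w
    (λ {a} a∈ → signed<0⇒<0 (R ∣ a ∣) (proj₁ (ok a∈)) , <0⇒signed<0 (proj₂ (ok a∈))))

stRank-mono-< : ∀ w {m m′} → m ∈ map ∣_∣ w → m < m′ → stRank w m < stRank w m′
stRank-mono-< w {m} {m′} m∈ m<m′ = subst₂ _<_ (sym (stRank≡suc-rank w m)) (sym (stRank≡suc-rank w m′))
  (s≤s (rank-mono-< (map ∣_∣ w) m∈ m<m′))

sst-monotoneAt : ∀ w {a b} → a ∈ w → b ∈ w → a ≢ 0ℤ → b ≢ 0ℤ → MonotoneAt (stRank w) a b
sst-monotoneAt w a∈ b∈ a≢0 b≢0 = record
  { a≢0 = a≢0 ; b≢0 = b≢0 ; 1≤Ra = s≤s z≤n ; 1≤Rb = s≤s z≤n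
  ; mono  = stRank-mono-< w (MP.∈-map⁺ ∣_∣ a∈)
  ; mono′ = stRank-mono-< w (MP.∈-map⁺ ∣_∣ b∈)
  }

∣sst∣↭oneTo : ∀ w {B} → map ∣_∣ w ↭ B → AllPairs _<_ B → map ∣_∣ (sst w) ↭ oneTo (length w)
∣sst∣↭oneTo w {B} w↭B B↑ = subst (λ z → map ∣_∣ (sst w) ↭ oneTo z) (LP.length-map ∣_∣ w)
  (↭-trans (↭-reflexive (trans (∣∣-map-relabel (stRank w) w) (LP.map-cong (stRank≡suc-rank w) (map ∣_∣ w))))
           (map-rank-↭ w↭B B↑))

private
  map-injectiveOn : ∀ (h : ℤ → ℤ) {xs ys} → (∀ {a b} → a ∈ xs → b ∈ ys → h a ≡ h b → a ≡ b) →
                    map h xs ≡ map h ys → xs ≡ ys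
  map-injectiveOn h {[]}     {[]}     _   _ = refl
  map-injectiveOn h {x ∷ xs} {y ∷ ys} inj e =
    cong₂ _∷_ (inj (here refl) (here refl) (LP.∷-injectiveˡ e))
              (map-injectiveOn h (λ a∈ b∈ → inj (there a∈) (there b∈)) (LP.∷-injectiveʳ e))

-- Equal absolute-value multisets give equal stRank, so sst acts on both words by one injective relabelling.
sst-injective : ∀ {p p′} → map ∣_∣ p′ ↭ map ∣_∣ p → (∀ {a} → a ∈ p → a ≢ 0ℤ) → (∀ {a} → a ∈ p′ → a ≢ 0ℤ) →
                sst p ≡ sst p′ → p ≡ p′
sst-injective {p} {p′} p′↭p p≢0 p′≢0 e =
  map-injectiveOn (relabel R) relabel-injectiveOn (trans e (LP.map-cong (λ a → cong (signed a) (sameRank ∣ a ∣)) p′))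
  where
  R = stRank p
  sameRank : ∀ m → stRank p′ m ≡ stRank p m
  sameRank m = trans (stRank≡suc-rank p′ m) (trans (cong suc (rank-↭ p′↭p m)) (sym (stRank≡suc-rank p m)))
  relabel-injectiveOn : ∀ {a b} → a ∈ p → b ∈ p′ → relabel R a ≡ relabel R b → a ≡ b
  relabel-injectiveOn {a} {b} a∈ b∈ he =
    signed-injective (s≤s z≤n) (p≢0 a∈) (p′≢0 b∈) (trans he (cong (signed b) (sym Ra≡Rb))) ∣a∣≡∣b∣
    where
    Ra≡Rb : R ∣ a ∣ ≡ R ∣ b ∣
    Ra≡Rb = trans (sym (∣signed∣ a (R ∣ a ∣))) (trans (cong ∣_∣ he) (∣signed∣ b (R ∣ b ∣)))
    ∣a∣≡∣b∣ : ∣ a ∣ ≡ ∣ b ∣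
    ∣a∣≡∣b∣ with ℕP.<-cmp ∣ a ∣ ∣ b ∣
    ... | tri≈ _ e _  = e
    ... | tri< lt _ _ = ⊥-elim (ℕP.<-irrefl Ra≡Rb (stRank-mono-< p (MP.∈-map⁺ ∣_∣ a∈) lt))
    ... | tri> _ _ gt = ⊥-elim (ℕP.<-irrefl (sym Ra≡Rb) (stRank-mono-< p (PermP.∈-resp-↭ p′↭p (MP.∈-map⁺ ∣_∣ b∈)) gt))

length-++-≥ˡ : ∀ (u T : List ℤ) → length u ≤ length (u ++ T)
length-++-≥ˡ u T = subst (length u ≤_) (sym (LP.length-++ u)) (ℕP.m≤m+n (length u) (length T))

DesD-++⁺ : ∀ u T x → DesD u x → DesD (u ++ T) x
DesD-++⁺ u T zero (2≤∣u∣ , s) =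
  ℕP.≤-trans 2≤∣u∣ (length-++-≥ˡ u T) ,
  subst₂ (λ z w → z ℤ.+ w ℤ.< 0ℤ) (sym (ent-++ˡ u T 0 (ℕP.≤-trans (s≤s z≤n) 2≤∣u∣))) (sym (ent-++ˡ u T 1 2≤∣u∣)) s
DesD-++⁺ u T (suc j) (lt , le) =
  ℕP.<-≤-trans lt (length-++-≥ˡ u T) ,
  subst₂ ℤ._≤_ (sym (ent-++ˡ u T (suc j) lt)) (sym (ent-++ˡ u T j (ℕP.<⇒≤ lt))) le

DesD-++⁻ : ∀ u T x → x < length u → (x ≡ 0 → 2 ≤ length u) → DesD (u ++ T) x → DesD u x
DesD-++⁻ u T zero    0<∣u∣ 2≤∣u∣ (_ , s) =
  2≤∣u∣ refl , subst₂ (λ z w → z ℤ.+ w ℤ.< 0ℤ) (ent-++ˡ u T 0 0<∣u∣) (ent-++ˡ u T 1 (2≤∣u∣ refl)) s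
DesD-++⁻ u T (suc j) lt    _     (_ , le) =
  lt , subst₂ ℤ._≤_ (ent-++ˡ u T (suc j) lt) (ent-++ˡ u T j (ℕP.<⇒≤ lt)) le

DesD-map-relabel⁺ : ∀ R u x → (∀ {a b} → a ∈ u → b ∈ u → MonotoneAt R a b) →
                    DesD u x → DesD (map (relabel R) u) x
DesD-map-relabel⁺ R u zero mono (2≤∣u∣ , s) =
  subst (2 ≤_) (sym (LP.length-map (relabel R) u)) 2≤∣u∣ ,
  subst₂ (λ z w → z ℤ.+ w ℤ.< 0ℤ) (sym (ent-map (relabel R) u 0 1≤∣u∣)) (sym (ent-map (relabel R) u 1 2≤∣u∣))
    (relabel-+<0 (mono (ent∈ u 0 1≤∣u∣) (ent∈ u 1 2≤∣u∣)) s)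
  where
  1≤∣u∣ = ℕP.≤-trans (s≤s z≤n) 2≤∣u∣
DesD-map-relabel⁺ R u (suc j) mono (lt , le) =
  subst (suc j <_) (sym (LP.length-map (relabel R) u)) lt ,
  subst₂ ℤ._≤_ (sym (ent-map (relabel R) u (suc j) lt)) (sym (ent-map (relabel R) u j (ℕP.<⇒≤ lt)))
    (relabel-mono-≤ (mono (ent∈ u j (ℕP.<⇒≤ lt)) (ent∈ u (suc j) lt)) le)

-- 0-based lookup with a junk value 0 past the end.
at : List ℕ → ℕ → ℕ
at []      _       = 0
at (x ∷ L) zero    = x
at (x ∷ L) (suc r) = at L r

at∈ : ∀ L {r} → r < length L → at L r ∈ L
at∈ (x ∷ L) {zero}  _       = here refl
at∈ (x ∷ L) {suc r} (s≤s p) = there (at∈ L p)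

at-mono-< : ∀ {L} → AllPairs _<_ L → ∀ {r r′} → r < r′ → r′ < length L → at L r < at L r′
at-mono-< {x ∷ L} (x<L ∷ _)  {zero}  {suc r′} _         (s≤s p) = All.lookup x<L (at∈ L p)
at-mono-< {x ∷ L} (_ ∷ L↑)   {suc r} {suc r′} (s≤s lt) (s≤s p) = at-mono-< L↑ lt p

map-at-upTo : ∀ L → map (at L) (upTo (length L)) ≡ L
map-at-upTo []      = refl
map-at-upTo (x ∷ L) = trans (cong (map (at (x ∷ L))) (upTo-suc (length L)))
  (cong (x ∷_) (trans (sym (LP.map-∘ (upTo (length L)))) (map-at-upTo L)))

-- The r-th smallest element of [n] ∖ X, for 1 ≤ r ≤ n - |X|.
nthNonElem : ∀ {n} → Subset n → ℕ → ℕ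
nthNonElem X r = at (nonElemsAsc X) (r ∸ 1)

inflate : ∀ {n} → Subset n → List ℤ → List ℤ
inflate X σ = map (relabel (nthNonElem X)) σ

module _ {n} (X : Subset n) where

  private
    k = length (nonElemsAsc X)

  nthNonElem-mono-< : ∀ {r r′} → r ∈ oneTo k → r′ ∈ oneTo k → r < r′ → nthNonElem X r < nthNonElem X r′
  nthNonElem-mono-< r∈ r′∈ r<r′ with ∈-oneTo⁻ r∈ | ∈-oneTo⁻ r′∈
  ... | _ , refl , _ | _ , refl , r′<k = at-mono-< (nonElemsAsc-increasing X) (ℕP.≤-pred r<r′) r′<k

  nthNonElem∈ : ∀ {r} → r ∈ oneTo k → nthNonElem X r ∈ nonElemsAsc X
  nthNonElem∈ r∈ with ∈-oneTo⁻ r∈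
  ... | _ , refl , r<k = at∈ (nonElemsAsc X) r<k

  nthNonElem-≥1 : ∀ {r} → r ∈ oneTo k → 1 ≤ nthNonElem X r
  nthNonElem-≥1 r∈ = ∈-nonElemsAsc⇒1≤ X (nthNonElem∈ r∈)

  nthNonElem-cancel-< : ∀ {r r′} → r ∈ oneTo k → r′ ∈ oneTo k →
                        nthNonElem X r < nthNonElem X r′ → r < r′
  nthNonElem-cancel-< {r} {r′} r∈ r′∈ lt = ℕP.≰⇒> r′≰r
    where
    r′≰r : ¬ (r′ ≤ r)
    r′≰r r′≤r with ℕP.m≤n⇒m<n∨m≡n r′≤r
    ... | inj₁ r′<r = ℕP.<-asym lt (nthNonElem-mono-< r′∈ r∈ r′<r)
    ... | inj₂ refl = ℕP.<-irrefl refl lt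

  map-nthNonElem-oneTo : map (nthNonElem X) (oneTo k) ≡ nonElemsAsc X
  map-nthNonElem-oneTo = trans (sym (LP.map-∘ (upTo k))) (map-at-upTo (nonElemsAsc X))

  inflate-monotoneAt : ∀ {a b} → ∣ a ∣ ∈ oneTo k → ∣ b ∣ ∈ oneTo k → MonotoneAt (nthNonElem X) a b
  inflate-monotoneAt a∈ b∈ = record
    { a≢0 = ∣∣∈oneTo⇒≢0 a∈ ; b≢0 = ∣∣∈oneTo⇒≢0 b∈ ; 1≤Ra = nthNonElem-≥1 a∈ ; 1≤Rb = nthNonElem-≥1 b∈
    ; mono = nthNonElem-mono-< a∈ b∈ ; mono′ = nthNonElem-mono-< b∈ a∈ }

  sst-inflate : ∀ {σ} → map ∣_∣ σ ↭ oneTo k → sst (inflate X σ) ≡ σ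
  sst-inflate {σ} σ↭ = trans (sym (LP.map-∘ σ)) (LP.map-id-local (All.tabulate roundTrip))
    where
    g = nthNonElem X
    ∣σ∣⊆ : ∀ {m} → m ∈ map ∣_∣ σ → m ∈ oneTo k
    ∣σ∣⊆ = PermP.∈-resp-↭ σ↭
    roundTrip : ∀ {a} → a ∈ σ → relabel (stRank (inflate X σ)) (relabel g a) ≡ a
    roundTrip {a} a∈ with ∈-oneTo⁻ (∣σ∣⊆ (MP.∈-map⁺ ∣_∣ a∈))
    ... | m , ∣a∣≡ , m<k = trans (cong (signed (relabel g a)) stRank≡∣a∣)
                                 (signed-signed (nthNonElem-≥1 a∈′) (∣∣∈oneTo⇒≢0 a∈′))
      where
      open ≡-Reasoning
      a∈′ = ∣σ∣⊆ (MP.∈-map⁺ ∣_∣ a∈)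
      stRank≡∣a∣ : stRank (inflate X σ) ∣ relabel g a ∣ ≡ ∣ a ∣
      stRank≡∣a∣ = begin
        stRank (inflate X σ) ∣ relabel g a ∣          ≡⟨ stRank≡suc-rank (inflate X σ) _ ⟩
        suc (rank (map ∣_∣ (inflate X σ)) ∣ relabel g a ∣) ≡⟨ cong₂ (λ L z → suc (rank L z)) (∣∣-map-relabel g σ) (∣signed∣ a (g ∣ a ∣)) ⟩
        suc (rank (map g (map ∣_∣ σ)) (g ∣ a ∣))         ≡⟨ cong suc (count-map (_<? g ∣ a ∣) g (map ∣_∣ σ)) ⟩
        suc (count (λ y → g y <? g ∣ a ∣) (map ∣_∣ σ))   ≡⟨ cong suc (count-cong (λ y → g y <? g ∣ a ∣) (_<? ∣ a ∣) (map ∣_∣ σ)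
                                                              (λ y∈ → nthNonElem-cancel-< (∣σ∣⊆ y∈) a∈′ , nthNonElem-mono-< (∣σ∣⊆ y∈) a∈′)) ⟩
        suc (rank (map ∣_∣ σ) ∣ a ∣)                     ≡⟨ cong suc (rank-↭ σ↭ ∣ a ∣) ⟩
        suc (rank (oneTo k) ∣ a ∣)                       ≡⟨ cong (λ z → suc (rank (oneTo k) z)) ∣a∣≡ ⟩
        suc (rank (oneTo k) (suc m))                     ≡⟨ cong suc (rank-oneTo k (ℕP.<⇒≤ m<k)) ⟩
        suc m                                            ≡⟨ ∣a∣≡ ⟨
        ∣ a ∣                                            ∎

HasCard-bijection : ∀ {A B : Set} {P : A → Set} {Q : B → Set} {c} (f : A → B) (g : B → A) →
                    (∀ {a} → P a → Q (f a)) → (∀ {a} → P a → g (f a) ≡ a) →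
                    (∀ {b} → Q b → P (g b)) → (∀ {b} → Q b → f (g b) ≡ b) →
                    HasCard P c → HasCard Q c
HasCard-bijection f g P⇒Qf gf≡ Q⇒Pg fg≡ (l , l! , ∣l∣≡c , l≐P) =
  map f l , map-f-unique , trans (LP.length-map f l) ∣l∣≡c , λ b → sound b , complete b
  where
  map-f-unique : Unique (map f l)
  map-f-unique = UniqueP.map⁻ {f = g}
    (subst Unique (sym (trans (sym (LP.map-∘ l)) (LP.map-id-local (All.tabulate (λ a∈ → gf≡ (proj₁ (l≐P _) a∈)))))) l!)
  sound : ∀ b → b ∈ map f l → _
  sound b b∈ with MP.∈-map⁻ f b∈
  ... | a , a∈ , refl = P⇒Qf (proj₁ (l≐P a) a∈)
  complete : ∀ b → _ → b ∈ map f l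
  complete b Qb = subst (_∈ map f l) (fg≡ Qb) (MP.∈-map⁺ f (proj₂ (l≐P (g b)) (Q⇒Pg Qb)))

length-cartesianProduct : ∀ {A B : Set} (xs : List A) (ys : List B) →
                          length (cartesianProduct xs ys) ≡ length xs * length ys
length-cartesianProduct []       ys = refl
length-cartesianProduct (x ∷ xs) ys = trans (LP.length-++ (map (x ,_) ys))
  (cong₂ _+_ (LP.length-map (x ,_) ys) (length-cartesianProduct xs ys))

HasCard-⟨×⟩ : ∀ {A B : Set} {P : A → Set} {Q : B → Set} {c d} →
              HasCard P c → HasCard Q d → HasCard (P ⟨×⟩ Q) (c * d)
HasCard-⟨×⟩ (xs , xs! , ∣xs∣≡c , xs≐P) (ys , ys! , ∣ys∣≡d , ys≐Q) =
  cartesianProduct xs ys , UniqueP.cartesianProduct⁺ xs! ys! ,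
  trans (length-cartesianProduct xs ys) (cong₂ _*_ ∣xs∣≡c ∣ys∣≡d) ,
  λ { (x , y) → (λ xy∈ → let x∈ , y∈ = MP.∈-cartesianProduct⁻ xs ys xy∈ in proj₁ (xs≐P x) x∈ , proj₁ (ys≐Q y) y∈)
              , (λ { (Px , Qy) → MP.∈-cartesianProduct⁺ (proj₂ (xs≐P x) Px) (proj₂ (ys≐Q y) Qy) }) }

subsetsOfSize : ∀ n → ℕ → List (Subset n)
subsetsOfSize zero    zero    = []ᵥ ∷ []
subsetsOfSize zero    (suc j) = []
subsetsOfSize (suc n) zero    = map (false ∷ᵥ_) (subsetsOfSize n zero)
subsetsOfSize (suc n) (suc j) = map (false ∷ᵥ_) (subsetsOfSize n (suc j)) ++ map (true ∷ᵥ_) (subsetsOfSize n j)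

length-subsetsOfSize : ∀ n j → length (subsetsOfSize n j) ≡ n C j
length-subsetsOfSize zero    zero    = refl
length-subsetsOfSize zero    (suc j) = refl
length-subsetsOfSize (suc n) zero    = trans (LP.length-map _ (subsetsOfSize n zero)) (length-subsetsOfSize n zero)
length-subsetsOfSize (suc n) (suc j) = begin
  length (map (false ∷ᵥ_) (subsetsOfSize n (suc j)) ++ map (true ∷ᵥ_) (subsetsOfSize n j))
    ≡⟨ LP.length-++ (map (false ∷ᵥ_) (subsetsOfSize n (suc j))) ⟩
  length (map (false ∷ᵥ_) (subsetsOfSize n (suc j))) + length (map (true ∷ᵥ_) (subsetsOfSize n j))
    ≡⟨ cong₂ _+_ (LP.length-map _ (subsetsOfSize n (suc j))) (LP.length-map _ (subsetsOfSize n j)) ⟩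
  length (subsetsOfSize n (suc j)) + length (subsetsOfSize n j)
    ≡⟨ cong₂ _+_ (length-subsetsOfSize n (suc j)) (length-subsetsOfSize n j) ⟩
  n C suc j + n C j
    ≡⟨ ℕP.+-comm (n C suc j) (n C j) ⟩
  n C j + n C suc j
    ≡⟨ nCk+nC[k+1]≡[n+1]C[k+1] n j ⟩
  suc n C suc j
    ∎
  where open ≡-Reasoning

∈-subsetsOfSize⁻ : ∀ n j {X : Subset n} → X ∈ subsetsOfSize n j → size X ≡ j
∈-subsetsOfSize⁻ zero    zero    {[]ᵥ} _ = refl
∈-subsetsOfSize⁻ (suc n) zero    X∈ with MP.∈-map⁻ (false ∷ᵥ_) X∈
... | Y , Y∈ , refl = ∈-subsetsOfSize⁻ n zero Y∈
∈-subsetsOfSize⁻ (suc n) (suc j) X∈ with MP.∈-++⁻ (map (false ∷ᵥ_) (subsetsOfSize n (suc j))) X∈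
... | inj₁ X∈′ with MP.∈-map⁻ (false ∷ᵥ_) X∈′
... | Y , Y∈ , refl = ∈-subsetsOfSize⁻ n (suc j) Y∈
∈-subsetsOfSize⁻ (suc n) (suc j) X∈ | inj₂ X∈′ with MP.∈-map⁻ (true ∷ᵥ_) X∈′
... | Y , Y∈ , refl = cong suc (∈-subsetsOfSize⁻ n j Y∈)

∈-subsetsOfSize⁺ : ∀ n (X : Subset n) → X ∈ subsetsOfSize n (size X)
∈-subsetsOfSize⁺ zero    []ᵥ          = here refl
∈-subsetsOfSize⁺ (suc n) (false ∷ᵥ X) with size X | ∈-subsetsOfSize⁺ n X
... | zero  | X∈ = MP.∈-map⁺ (false ∷ᵥ_) X∈
... | suc j | X∈ = MP.∈-++⁺ˡ (MP.∈-map⁺ (false ∷ᵥ_) X∈)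
∈-subsetsOfSize⁺ (suc n) (true ∷ᵥ X)  =
  MP.∈-++⁺ʳ (map (false ∷ᵥ_) (subsetsOfSize n (suc (size X)))) (MP.∈-map⁺ (true ∷ᵥ_) (∈-subsetsOfSize⁺ n X))

subsetsOfSize-unique : ∀ n j → Unique (subsetsOfSize n j)
subsetsOfSize-unique zero    zero    = [] ∷ []
subsetsOfSize-unique zero    (suc j) = []
subsetsOfSize-unique (suc n) zero    = UniqueP.map⁺ ∷-injectiveʳ (subsetsOfSize-unique n zero)
subsetsOfSize-unique (suc n) (suc j) =
  UniqueP.++⁺ (UniqueP.map⁺ ∷-injectiveʳ (subsetsOfSize-unique n (suc j)))
              (UniqueP.map⁺ ∷-injectiveʳ (subsetsOfSize-unique n j)) disjoint
  where
  disjoint : ∀ {V} → ¬ (V ∈ map (false ∷ᵥ_) (subsetsOfSize n (suc j)) × V ∈ map (true ∷ᵥ_) (subsetsOfSize n j))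
  disjoint (V∈₁ , V∈₂) with MP.∈-map⁻ (false ∷ᵥ_) V∈₁ | MP.∈-map⁻ (true ∷ᵥ_) V∈₂
  ... | _ , _ , refl | _ , _ , ()

HasCard-size≡ : ∀ n j → HasCard (λ (X : Subset n) → size X ≡ j) (n C j)
HasCard-size≡ n j = subsetsOfSize n j , subsetsOfSize-unique n j , length-subsetsOfSize n j ,
  λ X → ∈-subsetsOfSize⁻ n j , λ { refl → ∈-subsetsOfSize⁺ n X }

module _ {m w} (w∈D : InD m w) where

  private module PermS = PermSetoid (setoid ℕ)

  InD-length : length w ≡ m
  InD-length = trans (sym (LP.length-map ∣_∣ w)) (trans (PermP.↭-length (proj₁ w∈D)) (length-oneTo m))

  InD-∣∣∈oneTo : ∀ {a} → a ∈ w → ∣ a ∣ ∈ oneTo m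
  InD-∣∣∈oneTo a∈ = PermP.∈-resp-↭ (proj₁ w∈D) (MP.∈-map⁺ ∣_∣ a∈)

  InD-unique : Unique w
  InD-unique = UniqueP.map⁻ {f = ∣_∣}
    (PermS.Unique-resp-↭ (↭⇒↭ₛ (↭-sym (proj₁ w∈D))) (UniqueP.map⁺ ℕP.suc-injective (UniqueP.upTo⁺ m)))

map-∣∣-map-+ : ∀ xs → map ∣_∣ (map +_ xs) ≡ xs
map-∣∣-map-+ xs = trans (sym (LP.map-∘ xs)) (LP.map-id xs)

take-length-++ : ∀ {A : Set} (xs ys : List A) → take (length xs) (xs ++ ys) ≡ xs
take-length-++ []       ys = refl
take-length-++ (x ∷ xs) ys = cong (x ∷_) (take-length-++ xs ys)

drop-length-++ : ∀ {A : Set} (xs ys : List A) → drop (length xs) (xs ++ ys) ≡ ys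
drop-length-++ []       ys = refl
drop-length-++ (x ∷ xs) ys = drop-length-++ xs ys

private
  ↭-++-cancelʳ : ∀ {A : Set} (xs ys zs : List A) → xs ++ zs ↭ ys ++ zs → xs ↭ ys
  ↭-++-cancelʳ xs ys []       p = subst₂ _↭_ (LP.++-identityʳ xs) (LP.++-identityʳ ys) p
  ↭-++-cancelʳ xs ys (z ∷ zs) p = ↭-++-cancelʳ xs ys zs (PermP.drop-mid xs ys p)

  pos-+-pos≮0 : ∀ {a b} → 0ℤ ℤ.< a → 0ℤ ℤ.< b → ¬ (a ℤ.+ b ℤ.< 0ℤ)
  pos-+-pos≮0 0<a 0<b a+b<0 = ℤP.<-asym (ℤP.+-mono-< 0<a 0<b) a+b<0

module ψ-Bijection {n} (1≤n : 1 ≤ n) (S : Subset n) {i} (isRn : IsRn n S i) where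

  k : ℕ
  k = n ∸ i ∸ 1

  private
    suffix∈S : ∀ x → n ∸ i ≤ x → x < n → x ∈ₛ S
    suffix∈S = proj₂ (proj₁ isRn)

  k≤n : k ≤ n
  k≤n = ℕP.≤-trans (ℕP.m∸n≤m (n ∸ i) 1) (ℕP.m∸n≤m n i)

  k<n : k < n
  k<n with n ∸ i | ℕP.m∸n≤m n i
  ... | zero  | _      = 1≤n
  ... | suc _ | n∸i≤n = n∸i≤n

  n∸i≤1+k : n ∸ i ≤ suc (n ∸ i ∸ 1)
  n∸i≤1+k with n ∸ i
  ... | zero  = z≤n
  ... | suc _ = ℕP.≤-refl

  n∸i≡1+k : i < n → n ∸ i ≡ suc k
  n∸i≡1+k i<n with n ∸ i | ℕP.m<n⇒0<n∸m i<n
  ... | suc _ | _ = refl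

  k+1+i≡n : i < n → k + suc i ≡ n
  k+1+i≡n i<n = trans (ℕP.+-suc k i) (trans (cong (_+ i) (sym (n∸i≡1+k i<n))) (ℕP.m∸n+n≡m (ℕP.<⇒≤ i<n)))

  ent-++-suffix : ∀ u T → length u ≡ k → ∀ j → ent (u ++ T) (k + suc j) ≡ ent T (suc j)
  ent-++-suffix u T ∣u∣≡k j = subst (λ z → ent (u ++ T) (z + suc j) ≡ ent T (suc j)) ∣u∣≡k (ent-++ʳ u T j)

  module Domain (π : List ℤ) (π∈ : InDplusS n S π) where

    π∈D : InD n π
    π∈D = proj₁ (proj₁ π∈)

    private
      desS : ∀ x → x ∈ₛ S → DesD π x
      desS = proj₂ π∈

    p t : List ℤ
    p = take k π
    t = drop k π

    p++t≡π : p ++ t ≡ π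
    p++t≡π = LP.take++drop≡id k π

    length-p : length p ≡ k
    length-p = trans (LP.length-take k π) (trans (cong (k ℕ.⊓_) (InD-length π∈D)) (ℕP.m≤n⇒m⊓n≡m k≤n))

    length-t : length t ≡ n ∸ k
    length-t = trans (LP.length-drop k π) (cong (_∸ k) (InD-length π∈D))

    ent-π-t : ∀ j → ent π (k + suc j) ≡ ent t (suc j)
    ent-π-t j = subst (λ w → ent w (k + suc j) ≡ ent t (suc j)) p++t≡π (ent-++-suffix p t length-p j)

    -- Positions k+1, …, n-1 all lie in {n-i, …, n-1} ⊆ S.
    t-nonIncreasing : Linked ℤ._≥_ t
    t-nonIncreasing = Linked-fromEnt t descent
      where
      descent : ∀ j → suc j < length t → ent t (suc j) ℤ.≥ ent t (suc (suc j))
      descent j 1+j<∣t∣ = subst₂ ℤ._≤_ (trans (cong (ent π) 2+k+j≡) (ent-π-t (suc j)))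
                                       (trans (cong (ent π) (sym (ℕP.+-suc k j))) (ent-π-t j))
                                       (proj₂ des)
        where
        2+k+j≡ : suc (suc (k + j)) ≡ k + suc (suc j)
        2+k+j≡ = sym (trans (ℕP.+-suc k (suc j)) (cong suc (ℕP.+-suc k j)))
        lo : n ∸ i ≤ k + suc j
        lo = ℕP.≤-trans n∸i≤1+k (subst (suc k ≤_) (sym (ℕP.+-suc k j)) (s≤s (ℕP.m≤m+n k j)))
        hi : k + suc j < n
        hi = subst (k + suc j <_) (ℕP.m+[n∸m]≡n k≤n) (ℕP.+-monoʳ-< k (subst (suc j <_) length-t 1+j<∣t∣))
        des : DesD π (suc (k + j))
        des = subst (DesD π) (ℕP.+-suc k j) (desS _ (suffix∈S _ lo hi))

    t-last>0 : 0ℤ ℤ.< ent t (length t)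
    t-last>0 with length t | length-t
    ... | zero  | ∣t∣≡ = ⊥-elim (ℕP.<-irrefl ∣t∣≡ (ℕP.m<n⇒0<n∸m k<n))
    ... | suc j | ∣t∣≡ = subst (0ℤ ℤ.<_) (trans (cong (ent π) n≡) (ent-π-t j)) (proj₂ (proj₁ π∈))
      where
      n≡ : n ≡ k + suc j
      n≡ = sym (trans (cong (λ z → k + z) ∣t∣≡) (ℕP.m+[n∸m]≡n k≤n))

    t>0 : All (0ℤ ℤ.<_) t
    t>0 = Linked-≥⇒All-pos t t-nonIncreasing t-last>0

    t-decreasing : AllPairs ℤ._>_ t
    t-decreasing = Linked-≥∧Unique⇒AllPairs-> t-nonIncreasing (UniqueP.drop⁺ k (InD-unique π∈D))

    -- If i = n then 0 ∈ S and π = t is positive, so π(1) + π(2) < 0 is impossible.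
    i<n : i < n
    i<n with ℕP.m≤n⇒m<n∨m≡n (proj₁ (proj₁ isRn))
    ... | inj₁ i<n = i<n
    ... | inj₂ refl = ⊥-elim (pos-+-pos≮0 (All.lookup π>0 (ent∈ π 0 (ℕP.≤-trans (s≤s z≤n) 2≤∣π∣)))
                                          (All.lookup π>0 (ent∈ π 1 2≤∣π∣)) (proj₂ des₀))
      where
      n∸n≡0 = ℕP.n∸n≡0 n
      π>0 : All (0ℤ ℤ.<_) π
      π>0 = subst (λ z → All (0ℤ ℤ.<_) (drop (z ∸ 1) π)) n∸n≡0 t>0
      des₀ : DesD π 0
      des₀ = desS 0 (suffix∈S 0 (subst (_≤ 0) (sym n∸n≡0) z≤n) 1≤n)
      2≤∣π∣ : 2 ≤ length π
      2≤∣π∣ = proj₁ des₀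

    length-t≡1+i : length t ≡ suc i
    length-t≡1+i = trans length-t (trans (cong (_∸ k) (sym (k+1+i≡n i<n))) (ℕP.m+n∸m≡n k (suc i)))

    V : Subset n
    V = valueSet n i π

    t≡elemsDesc-V : t ≡ map +_ (elemsDesc V)
    t≡elemsDesc-V = AllPairs->⇒≡elemsDesc-memberSet t-decreasing t>0
      (λ a∈ → InD-∣∣∈oneTo π∈D (subst (_ ∈_) p++t≡π (MP.∈-++⁺ʳ p a∈)))

    size-V : size V ≡ suc i
    size-V = trans (sym (length-elemsDesc V))
      (trans (sym (LP.length-map +_ (elemsDesc V))) (trans (cong length (sym t≡elemsDesc-V)) length-t≡1+i))

    ∣p∣↭nonElemsAsc-V : map ∣_∣ p ↭ nonElemsAsc V
    ∣p∣↭nonElemsAsc-V = ↭-++-cancelʳ (map ∣_∣ p) (nonElemsAsc V) (elemsDesc V) (begin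
      map ∣_∣ p ++ elemsDesc V            ≡⟨ cong (map ∣_∣ p ++_) (map-∣∣-map-+ (elemsDesc V)) ⟨
      map ∣_∣ p ++ map ∣_∣ (map +_ (elemsDesc V)) ≡⟨ cong (λ u → map ∣_∣ p ++ map ∣_∣ u) t≡elemsDesc-V ⟨
      map ∣_∣ p ++ map ∣_∣ t              ≡⟨ LP.map-++ ∣_∣ p t ⟨
      map ∣_∣ (p ++ t)                    ≡⟨ cong (map ∣_∣) p++t≡π ⟩
      map ∣_∣ π                           ↭⟨ proj₁ π∈D ⟩
      oneTo n                             ↭⟨ nonElemsAsc++elemsDesc↭oneTo V ⟨
      nonElemsAsc V ++ elemsDesc V        ∎)
      where open PermutationReasoning

    p≢0 : ∀ {a} → a ∈ p → a ≢ 0ℤ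
    p≢0 a∈ = ∣∣∈oneTo⇒≢0 (InD-∣∣∈oneTo π∈D (subst (_ ∈_) p++t≡π (MP.∈-++⁺ˡ a∈)))

    negCount-p≡negCount-π : negCount p ≡ negCount π
    negCount-p≡negCount-π = begin
      negCount p                 ≡⟨ ℕP.+-identityʳ _ ⟨
      negCount p + 0             ≡⟨ cong (λ z → negCount p + z) (count-none (ℤ._<? 0ℤ) (All.map (λ 0<a a<0 → ℤP.<-asym 0<a a<0) t>0)) ⟨
      negCount p + negCount t    ≡⟨ count-++ (ℤ._<? 0ℤ) p t ⟨
      negCount (p ++ t)          ≡⟨ cong negCount p++t≡π ⟩
      negCount π                 ∎
      where open ≡-Reasoning

    σ : List ℤ
    σ = sst p

    σ∈D : InD k σ
    σ∈D = subst (λ z → map ∣_∣ σ ↭ oneTo z) length-p (∣sst∣↭oneTo p ∣p∣↭nonElemsAsc-V (nonElemsAsc-increasing V))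
        , subst (2 ∣_) (sym (trans (negCount-map-relabel (stRank p) p (λ a∈ → p≢0 a∈ , s≤s z≤n)) negCount-p≡negCount-π))
                (proj₂ π∈D)

    -- If k = 1 then π(1) + π(2) < 0 with π(2) ∈ t positive would leave π(1) as the only negative entry.
    2≤k : 0 ∈ₛ S → 0 < k → 2 ≤ k
    2≤k 0∈S 0<k with 2 ℕ.≤? k
    ... | yes 2≤k = 2≤k
    ... | no 2≰k with ℕP.≤-antisym (ℕP.≤-pred (ℕP.≰⇒> 2≰k)) 0<k
    ... | k≡1 = ⊥-elim (1≢2∣ (subst (2 ∣_) (trans (sym negCount-p≡negCount-π) negCount-p≡1) (proj₂ π∈D)))
      where
      1≢2∣ : ¬ (2 ∣ 1)
      1≢2∣ 2∣1 with ∣1⇒≡1 2∣1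
      ... | ()
      p₁+t₁<0 : ent p 1 ℤ.+ ent t 1 ℤ.< 0ℤ
      p₁+t₁<0 = subst₂ (λ a b → a ℤ.+ b ℤ.< 0ℤ)
        (trans (cong (λ w → ent w 1) (sym p++t≡π)) (ent-++ˡ p t 0 (subst (1 ≤_) (sym (trans length-p k≡1)) ℕP.≤-refl)))
        (trans (cong (λ z → ent π (z + 1)) (sym k≡1)) (ent-π-t 0))
        (proj₂ (desS 0 0∈S))
      p₁<0 : ent p 1 ℤ.< 0ℤ
      p₁<0 = ℤP.<-trans (+<0⇒<- (ent p 1) (ent t 1) p₁+t₁<0)
                        (ℤP.neg-mono-< (All.lookup t>0 (ent∈ t 0 (subst (1 ≤_) (sym length-t≡1+i) (s≤s z≤n)))))
      negCount-p≡1 : negCount p ≡ 1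
      negCount-p≡1 with p | trans length-p k≡1 | p₁<0
      ... | a ∷ [] | _ | a<0 = count-accept (ℤ._<? 0ℤ) [] a<0

    σ-descents : DesContains σ (λ x → (x < k) × (x ∈ₛ S))
    σ-descents x (x<k , x∈S) = DesD-map-relabel⁺ (stRank p) p x
      (λ a∈ b∈ → sst-monotoneAt p a∈ b∈ (p≢0 a∈) (p≢0 b∈))
      (DesD-++⁻ p t x (subst (x <_) (sym length-p) x<k)
        (λ { refl → subst (2 ≤_) (sym length-p) (2≤k x∈S x<k) })
        (subst (λ w → DesD w x) (sym p++t≡π) (desS x x∈S)))

    ψπ∈Cod : InCod n S i (ψ n i π)
    ψπ∈Cod = (σ∈D , σ-descents) , size-V

  ψ-injective : ∀ {π π′} → InDplusS n S π → InDplusS n S π′ → ψ n i π ≡ ψ n i π′ → π ≡ π′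
  ψ-injective {π} {π′} π∈ π′∈ ψ≡ = begin
    π              ≡⟨ D.p++t≡π ⟨
    D.p ++ D.t     ≡⟨ cong₂ _++_ p≡p′ t≡t′ ⟩
    D′.p ++ D′.t   ≡⟨ D′.p++t≡π ⟩
    π′             ∎
    where
    open ≡-Reasoning
    module D  = Domain π π∈
    module D′ = Domain π′ π′∈
    V≡V′ : D.V ≡ D′.V
    V≡V′ = cong proj₂ ψ≡
    t≡t′ : D.t ≡ D′.t
    t≡t′ = trans D.t≡elemsDesc-V (trans (cong (λ X → map +_ (elemsDesc X)) V≡V′) (sym D′.t≡elemsDesc-V))
    p≡p′ : D.p ≡ D′.p
    p≡p′ = sst-injective
      (↭-trans D′.∣p∣↭nonElemsAsc-V (↭-trans (↭-reflexive (cong nonElemsAsc (sym V≡V′))) (↭-sym D.∣p∣↭nonElemsAsc-V)))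
      D.p≢0 D′.p≢0 (cong proj₁ ψ≡)

  ψ⁻¹ : List ℤ → Subset n → List ℤ
  ψ⁻¹ σ X = inflate X σ ++ map +_ (elemsDesc X)

  module Codomain (σ : List ℤ) (X : Subset n) (σX∈ : InCod n S i (σ , X)) where

    private
      σ∈D : InD k σ
      σ∈D = proj₁ (proj₁ σX∈)
      size-X : size X ≡ suc i
      size-X = proj₂ σX∈

    i<n : i < n
    i<n = subst (_≤ n) size-X (∣p∣≤n X)

    length-nonElemsAsc-X : length (nonElemsAsc X) ≡ k
    length-nonElemsAsc-X = ℕP.+-cancelʳ-≡ (suc i) (length (nonElemsAsc X)) k
      (trans (subst (λ z → length (nonElemsAsc X) + z ≡ n) size-X (length-nonElemsAsc X)) (sym (k+1+i≡n i<n)))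

    ∣σ∣↭ : map ∣_∣ σ ↭ oneTo (length (nonElemsAsc X))
    ∣σ∣↭ = subst (λ z → map ∣_∣ σ ↭ oneTo z) (sym length-nonElemsAsc-X) (proj₁ σ∈D)

    u T π : List ℤ
    u = inflate X σ
    T = map +_ (elemsDesc X)
    π = ψ⁻¹ σ X

    length-u : length u ≡ k
    length-u = trans (LP.length-map _ σ) (InD-length σ∈D)

    length-T : length T ≡ suc i
    length-T = trans (LP.length-map +_ (elemsDesc X)) (trans (length-elemsDesc X) size-X)

    T>0 : All (0ℤ ℤ.<_) T
    T>0 = AllP.map⁺ (All.tabulate (λ m∈ → ℤ.+<+ (∈-elemsDesc⇒1≤ X m∈)))

    T-decreasing : AllPairs ℤ._>_ T
    T-decreasing = AllPairsP.map⁺ (AllPairs.map ℤ.+<+ (elemsDesc-decreasing X))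

    ∣σ∣⊆ : ∀ {a} → a ∈ σ → ∣ a ∣ ∈ oneTo (length (nonElemsAsc X))
    ∣σ∣⊆ a∈ = PermP.∈-resp-↭ ∣σ∣↭ (MP.∈-map⁺ ∣_∣ a∈)

    σ-monotoneAt : ∀ {a b} → a ∈ σ → b ∈ σ → MonotoneAt (nthNonElem X) a b
    σ-monotoneAt a∈ b∈ = inflate-monotoneAt X (∣σ∣⊆ a∈) (∣σ∣⊆ b∈)

    ∣π∣↭oneTo : map ∣_∣ π ↭ oneTo n
    ∣π∣↭oneTo = begin
      map ∣_∣ (u ++ T)                                    ≡⟨ LP.map-++ ∣_∣ u T ⟩
      map ∣_∣ u ++ map ∣_∣ T                              ≡⟨ cong₂ _++_ (∣∣-map-relabel (nthNonElem X) σ) (map-∣∣-map-+ (elemsDesc X)) ⟩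
      map (nthNonElem X) (map ∣_∣ σ) ++ elemsDesc X       ↭⟨ PermP.++⁺ʳ (elemsDesc X) (PermP.map⁺ (nthNonElem X) ∣σ∣↭) ⟩
      map (nthNonElem X) (oneTo (length (nonElemsAsc X))) ++ elemsDesc X ≡⟨ cong (_++ elemsDesc X) (map-nthNonElem-oneTo X) ⟩
      nonElemsAsc X ++ elemsDesc X                        ↭⟨ nonElemsAsc++elemsDesc↭oneTo X ⟩
      oneTo n                                             ∎
      where open PermutationReasoning

    negCount-π≡negCount-σ : negCount π ≡ negCount σ
    negCount-π≡negCount-σ = begin
      negCount (u ++ T)         ≡⟨ count-++ (ℤ._<? 0ℤ) u T ⟩
      negCount u + negCount T   ≡⟨ cong₂ _+_ (negCount-map-relabel (nthNonElem X) σ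
                                     (λ a∈ → ∣∣∈oneTo⇒≢0 (∣σ∣⊆ a∈) , nthNonElem-≥1 X (∣σ∣⊆ a∈)))
                                   (count-none (ℤ._<? 0ℤ) (All.map (λ 0<a a<0 → ℤP.<-asym 0<a a<0) T>0)) ⟩
      negCount σ + 0            ≡⟨ ℕP.+-identityʳ _ ⟩
      negCount σ                ∎
      where open ≡-Reasoning

    ent-π-T : ∀ j → ent π (k + suc j) ≡ ent T (suc j)
    ent-π-T = ent-++-suffix u T length-u

    π[n]>0 : 0ℤ ℤ.< ent π n
    π[n]>0 = subst (0ℤ ℤ.<_) (trans (sym (ent-π-T i)) (cong (ent π) (k+1+i≡n i<n)))
      (All.lookup T>0 (ent∈ T i (subst (suc i ≤_) (sym length-T) ℕP.≤-refl)))

    -- Position k cannot lie in S: together with {n-i, …, n-1} it would make r_n(S) ≥ i + 1.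
    k∉S : ¬ (k ∈ₛ S)
    k∉S k∈S = ℕP.<-irrefl refl (proj₂ isRn (suc i) (i<n , longerSuffix))
      where
      n∸[1+i]≡k : n ∸ suc i ≡ k
      n∸[1+i]≡k = sym (trans (ℕP.∸-+-assoc n i 1) (cong (n ∸_) (ℕP.+-comm i 1)))
      longerSuffix : ∀ y → n ∸ suc i ≤ y → y < n → y ∈ₛ S
      longerSuffix y lo y<n with ℕP.m≤n⇒m<n∨m≡n (subst (_≤ y) n∸[1+i]≡k lo)
      ... | inj₂ refl = k∈S
      ... | inj₁ k<y  = suffix∈S y (subst (_≤ y) (sym (n∸i≡1+k i<n)) k<y) y<n

    T-descent : ∀ j → suc j < suc i → DesD π (k + suc j)
    T-descent j 1+j<1+i = subst (DesD π) (sym (ℕP.+-suc k j))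
      ( subst₂ _<_ (ℕP.+-suc k j) (sym length-π) (ℕP.+-monoʳ-< k 1+j<1+i)
      , subst₂ ℤ._≤_ (sym (trans (cong (ent π) 2+k+j≡) (ent-π-T (suc j))))
                     (sym (trans (cong (ent π) (sym (ℕP.+-suc k j))) (ent-π-T j)))
                     (Linked-ent T (AllPairs->⇒Linked-≥ T-decreasing) j (subst (suc j <_) (sym length-T) 1+j<1+i)))
      where
      length-π : length π ≡ k + suc i
      length-π = trans (LP.length-++ u) (cong₂ _+_ length-u length-T)
      2+k+j≡ : suc (suc (k + j)) ≡ k + suc (suc j)
      2+k+j≡ = sym (trans (ℕP.+-suc k (suc j)) (cong suc (ℕP.+-suc k j)))

    π-descents : DesContains π (_∈ₛ S)
    π-descents x x∈S@(f , toℕf≡x , _) with ℕP.<-cmp x k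
    ... | tri< x<k _ _ = DesD-++⁺ (inflate X σ) T x
                           (DesD-map-relabel⁺ (nthNonElem X) σ x σ-monotoneAt (proj₂ (proj₁ σX∈) x (x<k , x∈S)))
    ... | tri≈ _ refl _ = ⊥-elim (k∉S x∈S)
    ... | tri> _ _ k<x = subst (DesD π) k+[x∸k]≡x (T-descent (x ∸ suc k) 1+j<1+i)
      where
      k+[x∸k]≡x : k + suc (x ∸ suc k) ≡ x
      k+[x∸k]≡x = trans (ℕP.+-suc k (x ∸ suc k)) (ℕP.m+[n∸m]≡n k<x)
      1+j<1+i : suc (x ∸ suc k) < suc i
      1+j<1+i = ℕP.+-cancelˡ-< k (suc (x ∸ suc k)) (suc i)
        (subst₂ _<_ (sym k+[x∸k]≡x) (sym (k+1+i≡n i<n)) (subst (_< n) toℕf≡x (toℕ<n f)))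

    π∈Dom : InDplusS n S π
    π∈Dom = ((∣π∣↭oneTo , subst (2 ∣_) (sym negCount-π≡negCount-σ) (proj₂ σ∈D)) , π[n]>0) , π-descents

    ψπ≡σX : ψ n i π ≡ (σ , X)
    ψπ≡σX = cong₂ _,_ (trans (cong sst take≡u) (sst-inflate X ∣σ∣↭))
                      (trans (cong (memberSet n) drop≡T) (memberSet-elemsDesc X))
      where
      take≡u : take k π ≡ u
      take≡u = trans (cong (λ z → take z π) (sym length-u)) (take-length-++ u T)
      drop≡T : drop k π ≡ T
      drop≡T = trans (cong (λ z → drop z π) (sym length-u)) (drop-length-++ u T)

  ψ-surjective : ∀ σ X → InCod n S i (σ , X) → Σ (List ℤ) (λ π → InDplusS n S π × (ψ n i π ≡ (σ , X)))
  ψ-surjective σ X σX∈ = ψ⁻¹ σ X , Codomain.π∈Dom σ X σX∈ , Codomain.ψπ≡σX σ X σX∈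

  ψ-card : ∀ {c} → HasCard (InDS∩ k S) c → HasCard (InDplusS n S) (c * (n C suc i))
  ψ-card cardCod = HasCard-bijection (λ (σ , X) → ψ⁻¹ σ X) (ψ n i)
    (λ { {σ , X} → Codomain.π∈Dom σ X })
    (λ { {σ , X} → Codomain.ψπ≡σX σ X })
    (λ {π} → Domain.ψπ∈Cod π)
    (λ {π} π∈ → let (σ , X) = ψ n i π ; σX∈ = Domain.ψπ∈Cod π π∈ in
                ψ-injective (Codomain.π∈Dom σ X σX∈) π∈ (Codomain.ψπ≡σX σ X σX∈))
    (HasCard-⟨×⟩ cardCod (HasCard-size≡ n (suc i)))

lemma3p1 : (n : ℕ) → 1 ≤ n → (S : Subset n) → (i : ℕ) → IsRn n S i →
    ((π : List ℤ) → InDplusS n S π → InCod n S i (ψ n i π))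
    × ((π π′ : List ℤ) → InDplusS n S π → InDplusS n S π′ → ψ n i π ≡ ψ n i π′ → π ≡ π′)
    × ((σ : List ℤ) → (X : Subset n) → InCod n S i (σ , X) →
        Σ (List ℤ) (λ π → InDplusS n S π × (ψ n i π ≡ (σ , X))))
    × ((c : ℕ) → HasCard (InDS∩ (n ∸ i ∸ 1) S) c → HasCard (InDplusS n S) (c * (n C suc i)))
lemma3p1 n 1≤n S i isRn =
  Domain.ψπ∈Cod , (λ _ _ → ψ-injective) , ψ-surjective , (λ _ → ψ-card)
  where open ψ-Bijection 1≤n S isRn
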